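{- Let $n\ge2$, let $\lambda$ be a nonzero $n$-partition with $\lambda_n=0$, and let $T$ be an $n$-semistandard tableau of shape $\lambda$. Then $\pi_T\in S_n^\lambda$.
   Context: Partitions and tableaux. An $n$-partition is $\lambda=(\lambda_1\ge\dots\ge\lambda_n\ge 0)$; its Young diagram has $\lambda_i$ left-justified boxes in row $i$; $c_j$ is the length of column $j$. Let $1\le\zeta_1<\dots<\zeta_d\le n-1$ be the distinct column lengths, $\zeta_0:=0$, $\zeta_{d+1}:=n$. $S_n^\lambda$ is the set of permutations $\phi$ (one-line form $(\phi_1,\dots,\phi_n)$) with $\phi_{\zeta_{h-1}+1}<\dots<\phi_{\zeta_h}$ for $1\le h\le d+1$. Location $(j,i)$ means column $j$, row $i$. Reading order: $(l,k)\le(j,i)$ iff $l<j$, or $l=j$ and $k\ge i$. An $n$-semistandard tableau $T$ of shape $\lambda$ fills the boxes with values in $[n]$, weakly increasing along rows, strictly increasing down columns; $T(j,i)$ is its entry at $(j,i)$, $C_j$ its column $j$. Greedy procedure. Permutations $\pi^{(j,i)}$ are produced for $(1,1)$ and all $(j,i)$ with $j\ge2$, in reading order. $\pi^{(1,1)}$ has first $c_1$ entries those of $C_1$ (increasing), then the rest of $[n]$ (increasing). For $j\ge2$, the predecessor of $(j,i)$ is $(j,i+1)$ if $i<c_j$ and $(j-1,1)$ if $i=c_j$; let $\pi$ be the permutation at the predecessor. If $T(j-1,i)=T(j,i)$, $\pi^{(j,i)}=\pi$. Otherwise $i_0:=i$, $i_1$ is the smallest index $>c_j$ with $\pi_{i_0}<\pi_{i_1}\le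 T(j,i)$, and repeatedly $i_x$ is the smallest index with $\pi_{i_{x-1}}<\pi_{i_x}\le T(j,i)$ until $\pi_{i_m}=T(j,i)$; then $\pi^{(j,i)}_{i_x}:=\pi_{i_{x-1}}$ ($1\le x\le m$), $\pi^{(j,i)}_{i_0}:=\pi_{i_m}$, other entries unchanged. $\pi_T:=\pi^{(\lambda_1,1)}$. -}

module Defs where

open import Data.Nat using (ℕ; zero; suc; _+_; _∸_; _≤_; _<_; _≤ᵇ_; _<ᵇ_; _≡ᵇ_; _≟_)
open import Data.Bool using (Bool; true; false; if_then_else_; _∧_; not)
open import Data.List using (List; []; _∷_; length; map; zip; upTo)
open import Data.Maybe using (Maybe; just; nothing; _>>=_)
open import Data.Product using (_×_; _,_; Σ; ∃)
open import Relation.Nullary using (¬_; yes; no)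
open import Relation.Binary.PropositionalEquality using (_≡_)

-- Conventions (all indices 1-based, as in the paper)
--   * an n-partition is a function  lam : ℕ → ℕ ; only lam 1 … lam n matter
--   * a tableau is a function  T : ℕ → ℕ → ℕ ,  T j i = entry at column j, row i;
--     only entries at boxes of the Young diagram matter
--   * a permutation in one-line form is a function  π : ℕ → ℕ ,
--     π p = p-th entry, for 1 ≤ p ≤ n

range : ℕ → ℕ → List ℕ
range a b = map (a +_) (upTo (suc b ∸ a))

filterB : {A : Set} → (A → Bool) → List A → List A
filterB p [] = []
filterB p (x ∷ xs) = if p x then x ∷ filterB p xs else filterB p xs

findFirst : (ℕ → Bool) → List ℕ → Maybe ℕ
findFirst p [] = nothing
findFirst p (x ∷ xs) = if p x then just x else findFirst p xs

nth : List ℕ → ℕ → ℕ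
nth [] _ = 0
nth (x ∷ xs) zero = x
nth (x ∷ xs) (suc k) = nth xs k

lastOr : ℕ → List ℕ → ℕ
lastOr d [] = d
lastOr d (x ∷ xs) = lastOr x xs

elemB : ℕ → List ℕ → Bool
elemB k [] = false
elemB k (x ∷ xs) = (k ≡ᵇ x) Data.Bool.∨ elemB k xs

IsPartition : ℕ → (ℕ → ℕ) → Set
IsPartition n lam = ∀ i → 1 ≤ i → i < n → lam (suc i) ≤ lam i

NonzeroPartition : ℕ → (ℕ → ℕ) → Set
NonzeroPartition n lam = Σ ℕ λ i → 1 ≤ i × i ≤ n × ¬ (lam i ≡ 0)

IsBox : ℕ → (ℕ → ℕ) → ℕ → ℕ → Set
IsBox n lam j i = 1 ≤ i × i ≤ n × 1 ≤ j × j ≤ lam i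

colLen : ℕ → (ℕ → ℕ) → ℕ → ℕ
colLen n lam j = length (filterB (λ i → j ≤ᵇ lam i) (range 1 n))

record IsSemistandard (n : ℕ) (lam : ℕ → ℕ) (T : ℕ → ℕ → ℕ) : Set where
  field
    entries : ∀ j i → IsBox n lam j i → 1 ≤ T j i × T j i ≤ n
    rows    : ∀ j i → IsBox n lam j i → IsBox n lam (suc j) i → T j i ≤ T (suc j) i
    columns : ∀ j i → IsBox n lam j i → IsBox n lam j (suc i) → T j i < T j (suc i)

IsPerm : ℕ → (ℕ → ℕ) → Set
IsPerm n π = (∀ p → 1 ≤ p → p ≤ n → 1 ≤ π p × π p ≤ n)
           × (∀ p q → 1 ≤ p → p ≤ n → 1 ≤ q → q ≤ n → π p ≡ π q → p ≡ q)

-- positions p < q lie in the same block (ζ_{h-1}, ζ_h] : no column length ζ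
-- (a length c_j of some column j, 1 ≤ j ≤ λ₁) satisfies p ≤ ζ < q
SameBlock : ℕ → (ℕ → ℕ) → ℕ → ℕ → Set
SameBlock n lam p q = ∀ j → 1 ≤ j → j ≤ lam 1 → ¬ (p ≤ colLen n lam j × colLen n lam j < q)

InS : ℕ → (ℕ → ℕ) → (ℕ → ℕ) → Set
InS n lam φ = IsPerm n φ
            × (∀ p q → 1 ≤ p → p < q → q ≤ n → SameBlock n lam p q → φ p < φ q)

-- The greedy procedure (Maybe: nothing if some step is undefined)

initPerm : ℕ → (ℕ → ℕ) → (ℕ → ℕ → ℕ) → (ℕ → ℕ)
initPerm n lam T p = nth (col1 Data.List.++ rest) (p ∸ 1)
  where
  col1 = map (T 1) (range 1 (colLen n lam 1))
  rest = filterB (λ v → not (elemB v col1)) (range 1 n)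

assoc : List (ℕ × ℕ) → ℕ → Maybe ℕ
assoc [] k = nothing
assoc ((a , b) ∷ xs) k = if k ≡ᵇ a then just b else assoc xs k

-- given indices i₀, i₁, …, i_m :  π'_{i_x} = π_{i_{x-1}},  π'_{i₀} = π_{i_m}
rotate : (ℕ → ℕ) → ℕ → List ℕ → (ℕ → ℕ)
rotate π i0 rest k with assoc ((i0 , π (lastOr i0 rest)) ∷ zip rest (map π (i0 ∷ rest))) k
... | just v = v
... | nothing = π k

-- the chain i_{x+1}, …, i_m following the current index cur (fuel bounds m)
chain : ℕ → (ℕ → ℕ) → ℕ → ℕ → ℕ → Maybe (List ℕ)
chain n π t zero cur = if π cur ≡ᵇ t then just [] else nothing
chain n π t (suc f) cur =
  if π cur ≡ᵇ t then just []
  else (findFirst (λ k → (π cur <ᵇ π k) ∧ (π k ≤ᵇ t)) (range 1 n) >>= λ nx →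
        chain n π t f nx >>= λ r → just (nx ∷ r))

-- π^{(j,i)} from π = permutation at the predecessor, for j ≥ 2
step : ℕ → (ℕ → ℕ) → (ℕ → ℕ → ℕ) → ℕ → ℕ → (ℕ → ℕ) → Maybe (ℕ → ℕ)
step n lam T j i π with T (j ∸ 1) i ≟ T j i
... | yes _ = just π
... | no _ =
  findFirst (λ k → (π i <ᵇ π k) ∧ (π k ≤ᵇ t)) (range (suc (colLen n lam j)) n) >>= λ i1 →
  chain n π t n i1 >>= λ r → just (rotate π i (i1 ∷ r))
  where t = T j i

-- process rows i = c, c-1, …, 1 of column j (bottom to top, i.e. reading order)
column : ℕ → (ℕ → ℕ) → (ℕ → ℕ → ℕ) → ℕ → ℕ → (ℕ → ℕ) → Maybe (ℕ → ℕ)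
column n lam T j zero π = just π
column n lam T j (suc i) π = step n lam T j (suc i) π >>= column n lam T j i

columns : ℕ → (ℕ → ℕ) → (ℕ → ℕ → ℕ) → List ℕ → (ℕ → ℕ) → Maybe (ℕ → ℕ)
columns n lam T [] π = just π
columns n lam T (j ∷ js) π = column n lam T j (colLen n lam j) π >>= columns n lam T js

greedy : ℕ → (ℕ → ℕ) → (ℕ → ℕ → ℕ) → Maybe (ℕ → ℕ)
greedy n lam T = columns n lam T (range 2 (lam 1)) (initPerm n lam T)

-- The proof runs the procedure symbolically, carrying an invariant.  After
-- column j is processed the current permutation π is a bijection of [n]
-- whose first c_j entries are column j of T, and whose later entries
-- increase within every block cut out by the lengths of columns 1, …, j
-- (AfterColumn).  The initial permutation satisfies this for j = 1, and for
-- j = λ₁ it says exactly π ∈ S_n^λ.  Inside a column the rows are processed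
-- bottom-up (InColumn).  At a box whose entry t exceeds the entry π_i to
-- its left, the chain i₀, i₁, …, i_m always exists, and the rotation along
-- it is the product of the transpositions (i₀ i₁), (i₀ i₂), …; each one
-- exchanges π_{i₀} with the first value in the window (π_{i₀}, t], which
-- sits below row c_j and keeps the blocks there increasing (GreedyStep).
-- Column-strictness of T keeps the other rows of the column out of the
-- window, so the procedure's search over all of [n] finds the same index.

module Submission where

open import Defs
open import Data.Nat
open import Data.Nat.Properties
open import Data.Bool using (Bool; true; false; _∧_; _∨_; not; if_then_else_) renaming (T to IsTrue)
open import Data.Bool.Properties using (T-≡; ∨-zeroʳ)
open import Data.List using (List; []; _∷_; length; map; zip; applyUpTo; _++_)
open import Data.List.Properties using (map-cong-local; length-map; length-++)
open import Data.List.Relation.Unary.All using (All; []; _∷_)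
import Data.List.Relation.Unary.All as All
open import Data.List.Relation.Unary.AllPairs using ([]; _∷_)
open import Data.List.Relation.Unary.Any using (here; there)
open import Data.List.Relation.Unary.Unique.Propositional using (Unique)
import Data.List.Relation.Unary.Unique.Propositional.Properties as Unique
open import Data.List.Membership.Propositional using (_∈_)
open import Data.List.Membership.Propositional.Properties using (∈-++⁺ˡ; ∈-++⁺ʳ; ∈-++⁻)
open import Data.Maybe using (Maybe; just; nothing; _>>=_; fromMaybe)
open import Data.Product using (Σ; _×_; _,_; proj₁; proj₂)
open import Data.Sum using (_⊎_; inj₁; inj₂) renaming ([_,_] to either)
open import Data.Empty using (⊥; ⊥-elim)
open import Function using (_⇔_; mk⇔; Equivalence; case_of_)
open import Relation.Nullary using (¬_; yes; no)
open import Relation.Binary.Definitions using (tri<; tri≈; tri>)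
open import Relation.Binary.PropositionalEquality

T⇒≡true : ∀ {b} → IsTrue b → b ≡ true
T⇒≡true = Equivalence.to T-≡

≡true⇒T : ∀ {b} → b ≡ true → IsTrue b
≡true⇒T = Equivalence.from T-≡

≡ᵇ-refl : ∀ m → (m ≡ᵇ m) ≡ true
≡ᵇ-refl m = T⇒≡true (≡⇒≡ᵇ m m refl)

≡ᵇ-sound : ∀ {m n} → (m ≡ᵇ n) ≡ true → m ≡ n
≡ᵇ-sound {m} {n} e = ≡ᵇ⇒≡ m n (≡true⇒T e)

≡ᵇ-false : ∀ {m n} → m ≢ n → (m ≡ᵇ n) ≡ false
≡ᵇ-false {m} {n} m≢n with m ≡ᵇ n in e
... | true = ⊥-elim (m≢n (≡ᵇ-sound e))
... | false = refl

≤ᵇ-complete : ∀ {m n} → m ≤ n → (m ≤ᵇ n) ≡ true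
≤ᵇ-complete m≤n = T⇒≡true (≤⇒≤ᵇ m≤n)

≤ᵇ-sound : ∀ {m n} → (m ≤ᵇ n) ≡ true → m ≤ n
≤ᵇ-sound {m} {n} e = ≤ᵇ⇒≤ m n (≡true⇒T e)

inWindow : ℕ → ℕ → ℕ → Bool
inWindow a t v = (a <ᵇ v) ∧ (v ≤ᵇ t)

InWindow : ℕ → ℕ → ℕ → Set
InWindow a t v = a < v × v ≤ t

inWindow-sound : ∀ a t v → inWindow a t v ≡ true → InWindow a t v
inWindow-sound a t v e with a <ᵇ v in e₁ | v ≤ᵇ t in e₂
inWindow-sound a t v refl | true | true = <ᵇ⇒< a v (≡true⇒T e₁) , ≤ᵇ-sound e₂

inWindow-complete : ∀ a t v → InWindow a t v → inWindow a t v ≡ true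
inWindow-complete a t v (a<v , v≤t) rewrite T⇒≡true (<⇒<ᵇ a<v) | ≤ᵇ-complete v≤t = refl

inWindow-false : ∀ a t v → ¬ InWindow a t v → inWindow a t v ≡ false
inWindow-false a t v outside with inWindow a t v in e
... | true = ⊥-elim (outside (inWindow-sound a t v e))
... | false = refl

inWindow-false⁻ : ∀ a t v → inWindow a t v ≡ false → ¬ InWindow a t v
inWindow-false⁻ a t v e inside with trans (sym e) (inWindow-complete a t v inside)
... | ()

interval : ℕ → ℕ → List ℕ
interval a zero = []
interval a (suc k) = a ∷ interval (suc a) k

map-applyUpTo-shift : ∀ a b k (f : ℕ → ℕ) → (∀ x → f x ≡ b + x) →
  map (a +_) (applyUpTo f k) ≡ interval (a + b) k
map-applyUpTo-shift a b zero f f≗ = refl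
map-applyUpTo-shift a b (suc k) f f≗ =
  cong₂ _∷_ (cong (a +_) (trans (f≗ 0) (+-identityʳ b)))
    (trans (map-applyUpTo-shift a (suc b) k (λ x → f (suc x)) (λ x → trans (f≗ (suc x)) (+-suc b x)))
           (cong (λ z → interval z k) (+-suc a b)))

range≡interval : ∀ a b → range a b ≡ interval a (suc b ∸ a)
range≡interval a b =
  trans (map-applyUpTo-shift a 0 (suc b ∸ a) (λ x → x) (λ x → refl))
        (cong (λ z → interval z (suc b ∸ a)) (+-identityʳ a))

a<a+suc : ∀ a k → a < a + suc k
a<a+suc a k = subst (a <_) (sym (+-suc a k)) (s≤s (m≤m+n a k))

<-+suc : ∀ {x} a k → x < suc a + k → x < a + suc k
<-+suc {x} a k = subst (x <_) (sym (+-suc a k))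

record IsFirst (p : ℕ → Bool) (a k y : ℕ) : Set where
  field
    lower : a ≤ y
    upper : y < a + k
    holds : p y ≡ true
    minimal : ∀ z → a ≤ z → z < y → p z ≡ false

findFirst-first : ∀ p a k {y} → findFirst p (interval a k) ≡ just y → IsFirst p a k y
findFirst-first p a zero ()
findFirst-first p a (suc k) e with p a in pa
findFirst-first p a (suc k) refl | true =
  record { lower = ≤-refl ; upper = a<a+suc a k ; holds = pa
         ; minimal = λ z a≤z z<a → ⊥-elim (<-irrefl refl (<-≤-trans z<a a≤z)) }
... | false = record
  { lower = <⇒≤ (IsFirst.lower rec)
  ; upper = <-+suc a k (IsFirst.upper rec)
  ; holds = IsFirst.holds rec
  ; minimal = minimal }
  where
  rec = findFirst-first p (suc a) k e
  minimal : ∀ z → a ≤ z → z < _ → p z ≡ false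
  minimal z a≤z z<y with m≤n⇒m<n∨m≡n a≤z
  ... | inj₁ a<z = IsFirst.minimal rec z a<z z<y
  ... | inj₂ refl = pa

findFirst-succeeds : ∀ p a k x → a ≤ x → x < a + k → p x ≡ true →
  Σ ℕ λ y → findFirst p (interval a k) ≡ just y
findFirst-succeeds p a zero x a≤x x<a =
  ⊥-elim (<-irrefl refl (<-≤-trans (subst (x <_) (+-identityʳ a) x<a) a≤x))
findFirst-succeeds p a (suc k) x a≤x x<a+k px with p a in pa
... | true = a , refl
... | false with m≤n⇒m<n∨m≡n a≤x
...   | inj₁ a<x = findFirst-succeeds p (suc a) k x a<x (subst (x <_) (+-suc a k) x<a+k) px
...   | inj₂ refl with trans (sym pa) px
...     | ()

findFirst-found : ∀ p a k x → a ≤ x → x < a + k → p x ≡ true →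
  Σ ℕ λ y → findFirst p (interval a k) ≡ just y × IsFirst p a k y
findFirst-found p a k x a≤x x<a+k px =
  let (y , e) = findFirst-succeeds p a k x a≤x x<a+k px in y , e , findFirst-first p a k e

findFirst-holds : ∀ p xs {y} → findFirst p xs ≡ just y → p y ≡ true
findFirst-holds p [] ()
findFirst-holds p (x ∷ xs) e with p x in px
findFirst-holds p (x ∷ xs) refl | true = px
... | false = findFirst-holds p xs e

findFirst-cong : ∀ p q xs → (∀ x → p x ≡ q x) → findFirst p xs ≡ findFirst q xs
findFirst-cong p q [] p≗q = refl
findFirst-cong p q (x ∷ xs) p≗q rewrite p≗q x with q x
... | true = refl
... | false = findFirst-cong p q xs p≗q

filter-length-≤ : ∀ P a k → length (filterB P (interval a k)) ≤ k
filter-length-≤ P a zero = z≤n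
filter-length-≤ P a (suc k) with P a
... | true = s≤s (filter-length-≤ P (suc a) k)
... | false = m≤n⇒m≤1+n (filter-length-≤ P (suc a) k)

filter-none : ∀ P a k → (∀ x → a ≤ x → x < a + k → P x ≡ false) →
  length (filterB P (interval a k)) ≡ 0
filter-none P a zero none = refl
filter-none P a (suc k) none rewrite none a ≤-refl (a<a+suc a k) =
  filter-none P (suc a) k (λ x a<x x<a+k → none x (<⇒≤ a<x) (<-+suc a k x<a+k))

DownClosed : (ℕ → Bool) → ℕ → ℕ → Set
DownClosed P a k = ∀ x y → a ≤ x → x ≤ y → y < a + k → P y ≡ true → P x ≡ true

filter-prefix : ∀ P a k → DownClosed P a k → ∀ x → a ≤ x → x < a + k →
  P x ≡ true ⇔ x < a + length (filterB P (interval a k))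
filter-prefix P a zero _ x a≤x x<a =
  ⊥-elim (<-irrefl refl (<-≤-trans (subst (x <_) (+-identityʳ a) x<a) a≤x))
filter-prefix P a (suc k) closed x a≤x x<a+k with P a in pa
... | true with m≤n⇒m<n∨m≡n a≤x
...   | inj₂ refl = mk⇔ (λ _ → a<a+suc a _) (λ _ → pa)
...   | inj₁ a<x = mk⇔ (λ px → <-+suc a _ (Equivalence.to rec px))
                      (λ x< → Equivalence.from rec (subst (x <_) (+-suc a _) x<))
  where
  rec = filter-prefix P (suc a) k
          (λ x′ y′ a<x′ x′≤y′ y′< → closed x′ y′ (<⇒≤ a<x′) x′≤y′ (<-+suc a k y′<))
          x a<x (subst (x <_) (+-suc a k) x<a+k)
filter-prefix P a (suc k) closed x a≤x x<a+k | false =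
  mk⇔ (λ px → ⊥-elim (true≢false (trans (sym (closed a x ≤-refl a≤x x<a+k px)) pa)))
      (λ x<a → ⊥-elim (<-irrefl refl (<-≤-trans (subst (x <_) a+0 x<a) a≤x)))
  where
  true≢false : true ≢ false
  true≢false ()
  nothing-kept : ∀ y → suc a ≤ y → y < suc a + k → P y ≡ false
  nothing-kept y a<y y< with P y in py
  ... | false = refl
  ... | true = ⊥-elim (true≢false (trans (sym (closed a y ≤-refl (<⇒≤ a<y) (<-+suc a k y<) py)) pa))
  a+0 : a + length (filterB P (interval (suc a) k)) ≡ a
  a+0 = trans (cong (a +_) (filter-none P (suc a) k nothing-kept)) (+-identityʳ a)

partition-antitone : ∀ {n lam} → IsPartition n lam → ∀ x y → 1 ≤ x → x ≤ y → y ≤ n → lam y ≤ lam x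
partition-antitone P x y 1≤x x≤y y≤n with m≤n⇒m<n∨m≡n x≤y
... | inj₂ refl = ≤-refl
... | inj₁ x<y with y
...   | suc y′ = ≤-trans (P y′ (≤-trans 1≤x (≤-pred x<y)) y≤n)
                         (partition-antitone P x y′ 1≤x (≤-pred x<y) (<⇒≤ y≤n))

colLen-≤ : ∀ n lam j → colLen n lam j ≤ n
colLen-≤ n lam j rewrite range≡interval 1 n = filter-length-≤ (λ i → j ≤ᵇ lam i) 1 n

colLen-spec : ∀ {n lam} → IsPartition n lam → ∀ j i → 1 ≤ i → i ≤ n →
  j ≤ lam i ⇔ i ≤ colLen n lam j
colLen-spec {n} {lam} P j i 1≤i i≤n rewrite range≡interval 1 n =
  mk⇔ (λ j≤ → ≤-pred (Equivalence.to spec (≤ᵇ-complete j≤)))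
      (λ i≤ → ≤ᵇ-sound (Equivalence.from spec (s≤s i≤)))
  where
  closed : DownClosed (λ i → j ≤ᵇ lam i) 1 n
  closed x y 1≤x x≤y y<n py =
    ≤ᵇ-complete (≤-trans (≤ᵇ-sound {j} py) (partition-antitone P x y 1≤x x≤y (≤-pred y<n)))
  spec = filter-prefix (λ i → j ≤ᵇ lam i) 1 n closed i 1≤i (s≤s i≤n)

colLen-antitone : ∀ {n lam} → IsPartition n lam → ∀ j → colLen n lam (suc j) ≤ colLen n lam j
colLen-antitone {n} {lam} P j with colLen n lam (suc j) in e
... | zero = z≤n
... | suc c = Equivalence.to (colLen-spec P j (suc c) (s≤s z≤n) c≤n)
                (≤-trans (n≤1+n j) (Equivalence.from (colLen-spec P (suc j) (suc c) (s≤s z≤n) c≤n) (≤-reflexive (sym e))))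
  where
  c≤n : suc c ≤ n
  c≤n = subst (_≤ n) e (colLen-≤ n lam (suc j))

colLen-box : ∀ {n lam} → IsPartition n lam → ∀ j i → 1 ≤ j → 1 ≤ i → i ≤ colLen n lam j → IsBox n lam j i
colLen-box {n} {lam} P j i 1≤j 1≤i i≤c = 1≤i , i≤n , 1≤j , Equivalence.from (colLen-spec P j i 1≤i i≤n) i≤c
  where
  i≤n : i ≤ n
  i≤n = ≤-trans i≤c (colLen-≤ n lam j)

module _ {n lam T} (P : IsPartition n lam) (S : IsSemistandard n lam T) where

  column-increasing : ∀ j p q → 1 ≤ j → 1 ≤ p → p < q → q ≤ colLen n lam j → T j p < T j q
  column-increasing j p (suc q) 1≤j 1≤p p<q q≤c with m≤n⇒m<n∨m≡n (≤-pred p<q)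
  ... | inj₂ refl = IsSemistandard.columns S j p (colLen-box P j p 1≤j 1≤p (<⇒≤ q≤c))
                                                 (colLen-box P j (suc p) 1≤j (s≤s z≤n) q≤c)
  ... | inj₁ p<q′ = <-trans (column-increasing j p q 1≤j 1≤p p<q′ (<⇒≤ q≤c))
                      (IsSemistandard.columns S j q (colLen-box P j q 1≤j (≤-trans 1≤p (<⇒≤ p<q′)) (<⇒≤ q≤c))
                                                     (colLen-box P j (suc q) 1≤j (s≤s z≤n) q≤c))

  row-weakly-increasing : ∀ j i → 1 ≤ j → 1 ≤ i → i ≤ colLen n lam (suc j) → T j i ≤ T (suc j) i
  row-weakly-increasing j i 1≤j 1≤i i≤c =
    IsSemistandard.rows S j i (colLen-box P j i 1≤j 1≤i (≤-trans i≤c (colLen-antitone P j)))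
                              (colLen-box P (suc j) i (s≤s z≤n) 1≤i i≤c)

  entry-≤ : ∀ j i → 1 ≤ j → 1 ≤ i → i ≤ colLen n lam j → 1 ≤ T j i × T j i ≤ n
  entry-≤ j i 1≤j 1≤i i≤c = IsSemistandard.entries S j i (colLen-box P j i 1≤j 1≤i i≤c)

-- π restricts to a bijection of [n] = {1, …, n}.  Surjectivity is what
-- guarantees that the value sought by a greedy step occurs somewhere.
record IsBijection (n : ℕ) (π : ℕ → ℕ) : Set where
  field
    bounded : ∀ p → 1 ≤ p → p ≤ n → 1 ≤ π p × π p ≤ n
    injective : ∀ p q → 1 ≤ p → p ≤ n → 1 ≤ q → q ≤ n → π p ≡ π q → p ≡ q
    surjective : ∀ v → 1 ≤ v → v ≤ n → Σ ℕ λ p → 1 ≤ p × p ≤ n × π p ≡ v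

bijection-ext : ∀ {n π σ} → (∀ k → σ k ≡ π k) → IsBijection n π → IsBijection n σ
bijection-ext {n} σ≗π B = record
  { bounded = λ p 1≤p p≤n → subst (λ v → 1 ≤ v × v ≤ n) (sym (σ≗π p)) (bounded p 1≤p p≤n)
  ; injective = λ p q a b c d e → injective p q a b c d (trans (sym (σ≗π p)) (trans e (σ≗π q)))
  ; surjective = λ v 1≤v v≤n → let (p , 1≤p , p≤n , πp) = surjective v 1≤v v≤n
                               in p , 1≤p , p≤n , trans (σ≗π p) πp }
  where open IsBijection B

bijection-∘ : ∀ {n π τ} → IsBijection n π → IsBijection n τ → IsBijection n (λ x → π (τ x))
bijection-∘ {n} {π} {τ} Bπ Bτ = record
  { bounded = λ p a b → let (c , d) = bounded Bτ p a b in bounded Bπ (τ p) c d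
  ; injective = λ p q a b c d e →
      let (a′ , b′) = bounded Bτ p a b ; (c′ , d′) = bounded Bτ q c d
      in injective Bτ p q a b c d (injective Bπ (τ p) (τ q) a′ b′ c′ d′ e)
  ; surjective = λ v a b →
      let (p , x , y , πp) = surjective Bπ v a b ; (p′ , x′ , y′ , τp′) = surjective Bτ p x y
      in p′ , x′ , y′ , trans (cong π τp′) πp }
  where open IsBijection

bijection⇒IsPerm : ∀ {n π} → IsBijection n π → IsPerm n π
bijection⇒IsPerm B = IsBijection.bounded B , IsBijection.injective B

transpose : ℕ → ℕ → ℕ → ℕ
transpose a b x = if x ≡ᵇ a then b else (if x ≡ᵇ b then a else x)

transpose-a : ∀ a b → transpose a b a ≡ b
transpose-a a b rewrite ≡ᵇ-refl a = refl

transpose-b : ∀ a b → transpose a b b ≡ a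
transpose-b a b with b ≡ᵇ a in e
... | true = ≡ᵇ-sound e
... | false rewrite ≡ᵇ-refl b = refl

transpose-other : ∀ a b x → x ≢ a → x ≢ b → transpose a b x ≡ x
transpose-other a b x x≢a x≢b rewrite ≡ᵇ-false x≢a | ≡ᵇ-false x≢b = refl

transpose-cases : ∀ a b x →
  (x ≡ a × transpose a b x ≡ b) ⊎ (x ≡ b × transpose a b x ≡ a) ⊎ (transpose a b x ≡ x)
transpose-cases a b x with x ≟ a
... | yes refl = inj₁ (refl , transpose-a x b)
... | no x≢a with x ≟ b
...   | yes refl = inj₂ (inj₁ (refl , transpose-b a x))
...   | no x≢b = inj₂ (inj₂ (transpose-other a b x x≢a x≢b))

transpose-involutive : ∀ a b x → transpose a b (transpose a b x) ≡ x
transpose-involutive a b x with transpose-cases a b x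
... | inj₁ (refl , e) rewrite e = transpose-b x b
... | inj₂ (inj₁ (refl , e)) rewrite e = transpose-a a x
... | inj₂ (inj₂ e) rewrite e = e

transpose-bijection : ∀ n a b → 1 ≤ a → a ≤ n → 1 ≤ b → b ≤ n → IsBijection n (transpose a b)
transpose-bijection n a b 1≤a a≤n 1≤b b≤n = record
  { bounded = bounded
  ; injective = λ p q _ _ _ _ e → trans (sym (transpose-involutive a b p))
                                  (trans (cong (transpose a b) e) (transpose-involutive a b q))
  ; surjective = λ v 1≤v v≤n → let (lo , hi) = bounded v 1≤v v≤n
                               in transpose a b v , lo , hi , transpose-involutive a b v }
  where
  bounded : ∀ x → 1 ≤ x → x ≤ n → 1 ≤ transpose a b x × transpose a b x ≤ n
  bounded x 1≤x x≤n with transpose-cases a b x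
  ... | inj₁ (_ , e) rewrite e = 1≤b , b≤n
  ... | inj₂ (inj₁ (_ , e)) rewrite e = 1≤a , a≤n
  ... | inj₂ (inj₂ e) rewrite e = 1≤x , x≤n

swap : (ℕ → ℕ) → ℕ → ℕ → (ℕ → ℕ)
swap π a b x = π (transpose a b x)

swap-other : ∀ π a b x → x ≢ a → x ≢ b → swap π a b x ≡ π x
swap-other π a b x x≢a x≢b = cong π (transpose-other a b x x≢a x≢b)

-- The rotation performed by a greedy step is a product of transpositions:
-- rotating along i₀, i₁, …, i_m is swapping positions i₀ and i₁ and then
-- rotating along i₀, i₂, …, i_m.

rotationTable : (ℕ → ℕ) → ℕ → List ℕ → List (ℕ × ℕ)
rotationTable π i0 rest = (i0 , π (lastOr i0 rest)) ∷ zip rest (map π (i0 ∷ rest))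

rotate-table : ∀ π i0 rest k → rotate π i0 rest k ≡ fromMaybe (π k) (assoc (rotationTable π i0 rest) k)
rotate-table π i0 rest k with assoc (rotationTable π i0 rest) k
... | just v = refl
... | nothing = refl

assoc-hit : ∀ k v L → assoc ((k , v) ∷ L) k ≡ just v
assoc-hit k v L rewrite ≡ᵇ-refl k = refl

assoc-skip : ∀ k a v L → k ≢ a → assoc ((a , v) ∷ L) k ≡ assoc L k
assoc-skip k a v L k≢a rewrite ≡ᵇ-false k≢a = refl

assoc-absent : ∀ k (r : List ℕ) vs → All (k ≢_) r → assoc (zip r vs) k ≡ nothing
assoc-absent k [] vs _ = refl
assoc-absent k (x ∷ r) [] _ = refl
assoc-absent k (x ∷ r) (v ∷ vs) (k≢x ∷ ks) rewrite ≡ᵇ-false k≢x = assoc-absent k r vs ks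

rotate-[] : ∀ π i0 k → rotate π i0 [] k ≡ π k
rotate-[] π i0 k rewrite rotate-table π i0 [] k with k ≟ i0
... | yes refl rewrite ≡ᵇ-refl k = refl
... | no k≢i0 rewrite ≡ᵇ-false k≢i0 = refl

lastOr-∈ : ∀ x xs → lastOr x xs ∈ (x ∷ xs)
lastOr-∈ x [] = here refl
lastOr-∈ x (y ∷ ys) = there (lastOr-∈ y ys)

swap-map-other : ∀ π i0 i1 r → All (i0 ≢_) r → All (i1 ≢_) r → map (swap π i0 i1) r ≡ map π r
swap-map-other π i0 i1 r i0∉r i1∉r =
  map-cong-local (All.zipWith (λ (i0≢y , i1≢y) → swap-other π i0 i1 _ (≢-sym i0≢y) (≢-sym i1≢y)) (i0∉r , i1∉r))

rotate-∷ : ∀ π i0 i1 r → All (i0 ≢_) r → All (i1 ≢_) r →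
  ∀ k → rotate π i0 (i1 ∷ r) k ≡ rotate (swap π i0 i1) i0 r k
rotate-∷ π i0 i1 r i0∉r i1∉r k
  rewrite rotate-table π i0 (i1 ∷ r) k | rotate-table (swap π i0 i1) i0 r k with k ≟ i0
... | yes refl rewrite ≡ᵇ-refl k = last-agrees r i0∉r i1∉r
  where
  last-agrees : ∀ r → All (k ≢_) r → All (i1 ≢_) r → π (lastOr i1 r) ≡ swap π k i1 (lastOr k r)
  last-agrees [] _ _ = sym (cong π (transpose-a k i1))
  last-agrees (x ∷ xs) k∉ i1∉ = sym (swap-other π k i1 (lastOr x xs)
    (λ e → All.lookup k∉ (lastOr-∈ x xs) (sym e)) (λ e → All.lookup i1∉ (lastOr-∈ x xs) (sym e)))
... | no k≢i0
  rewrite assoc-skip k i0 (π (lastOr i1 r)) ((i1 , π i0) ∷ zip r (map π (i1 ∷ r))) k≢i0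
        | assoc-skip k i0 (swap π i0 i1 (lastOr i0 r)) (zip r (map (swap π i0 i1) (i0 ∷ r))) k≢i0
        with k ≟ i1
...   | yes refl rewrite assoc-hit k (π i0) (zip r (map π (k ∷ r)))
                       | assoc-absent k r (map (swap π i0 k) (i0 ∷ r)) i1∉r = sym (cong π (transpose-b i0 k))
...   | no k≢i1 rewrite assoc-skip k i1 (π i0) (zip r (map π (i1 ∷ r))) k≢i1
                      | swap-other π i0 i1 k k≢i0 k≢i1
                      | swap-map-other π i0 i1 r i0∉r i1∉r
                      | transpose-a i0 i1 = refl

>>=-just⁻ : ∀ {A B : Set} {m : Maybe A} {g : A → Maybe B} {y} → (m >>= g) ≡ just y →
  Σ A λ x → m ≡ just x × g x ≡ just y
>>=-just⁻ {m = just x} e = x , refl , e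

>>=-just : ∀ {A B : Set} {m : Maybe A} {x : A} (g : A → Maybe B) → m ≡ just x → (m >>= g) ≡ g x
>>=-just g refl = refl

chain-increasing : ∀ n π t f c {r} → chain n π t f c ≡ just r → All (λ y → π c < π y) r
chain-increasing n π t zero c e with π c ≡ᵇ t
chain-increasing n π t zero c refl | true = []
chain-increasing n π t (suc f) c e with π c ≡ᵇ t
chain-increasing n π t (suc f) c refl | true = []
... | false with >>=-just⁻ {m = findFirst (λ k → inWindow (π c) t (π k)) (range 1 n)} e
...   | nx , found , e′ with >>=-just⁻ {m = chain n π t f nx} e′
...     | r′ , ch , refl = πc<πnx ∷ All.map (<-trans πc<πnx) (chain-increasing n π t f nx ch)
  where
  πc<πnx : π c < π nx
  πc<πnx = proj₁ (inWindow-sound (π c) t (π nx) (findFirst-holds (λ k → inWindow (π c) t (π k)) (range 1 n) found))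

window-agree : ∀ a t (π π′ : ℕ → ℕ) → (∀ k → a < π k → π′ k ≡ π k) → (∀ k → a < π′ k → π k ≡ π′ k) →
  ∀ k → inWindow a t (π k) ≡ inWindow a t (π′ k)
window-agree a t π π′ above above′ k with a <? π k
... | yes lt = cong (inWindow a t) (sym (above k lt))
... | no ¬lt with a <? π′ k
...   | yes lt′ = cong (inWindow a t) (above′ k lt′)
...   | no ¬lt′ = trans (inWindow-false a t (π k) (λ (lt , _) → ¬lt lt))
                          (sym (inWindow-false a t (π′ k) (λ (lt , _) → ¬lt′ lt)))

chain-cong : ∀ n π π′ t f c c′ → π c ≡ π′ c′ →
  (∀ k → π c < π k → π′ k ≡ π k) → (∀ k → π′ c′ < π′ k → π k ≡ π′ k) →
  chain n π t f c ≡ chain n π′ t f c′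
chain-cong n π π′ t zero c c′ e _ _ rewrite e = refl
chain-cong n π π′ t (suc f) c c′ e above above′ rewrite e with π′ c′ ≡ᵇ t
... | true = refl
... | false rewrite findFirst-cong (λ k → inWindow (π′ c′) t (π k)) (λ k → inWindow (π′ c′) t (π′ k)) (range 1 n)
                  (window-agree (π′ c′) t π π′ above above′)
  with findFirst (λ k → inWindow (π′ c′) t (π′ k)) (range 1 n) in found
...   | nothing = refl
...   | just nx = cong (_>>= λ r → just (nx ∷ r))
          (chain-cong n π π′ t f nx nx (sym π′nx≡πnx)
             (λ k πnx<πk → above k (<-trans (subst (π′ c′ <_) π′nx≡πnx π′c′<π′nx) πnx<πk))
             (λ k π′nx<π′k → above′ k (<-trans π′c′<π′nx π′nx<π′k)))
  where
  π′c′<π′nx : π′ c′ < π′ nx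
  π′c′<π′nx = proj₁ (inWindow-sound (π′ c′) t (π′ nx) (findFirst-holds (λ k → inWindow (π′ c′) t (π′ k)) (range 1 n) found))
  π′nx≡πnx : π′ nx ≡ π nx
  π′nx≡πnx = sym (above′ nx π′c′<π′nx)

chain-done : ∀ n π t f c → π c ≡ t → chain n π t f c ≡ just []
chain-done n π t zero c refl rewrite ≡ᵇ-refl (π c) = refl
chain-done n π t (suc f) c refl rewrite ≡ᵇ-refl (π c) = refl

chain-next : ∀ n π t f c {nx r} → π c ≢ t →
  findFirst (λ k → inWindow (π c) t (π k)) (range 1 n) ≡ just nx → chain n π t f nx ≡ just r →
  chain n π t (suc f) c ≡ just (nx ∷ r)
chain-next n π t f c πc≢t found ch rewrite ≡ᵇ-false πc≢t =
  trans (>>=-just _ found) (>>=-just _ ch)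

-- One greedy step, abstracted from tableaux.  The box being processed sits
-- in row i0 of a column of length c, t is its target value, Block p q says
-- that rows c < p < q lie in one block, and φ gives the values of the
-- first c rows when the step begins.
module GreedyStep (n c i0 t : ℕ) (Block : ℕ → ℕ → Set) (φ : ℕ → ℕ)
                  (1≤i0 : 1 ≤ i0) (i0≤c : i0 ≤ c) (c≤n : c ≤ n) (t≤n : t ≤ n) where

  -- Invariant of the step, preserved by each transposition (i0 i_x): π is a
  -- bijection, π i0 has not passed t, the other rows of the column keep
  -- their values and none of them lies in the window (π i0, t], and below
  -- row c the values increase within each block.
  record Good (π : ℕ → ℕ) : Set where
    field
      bijection : IsBijection n π
      at-most-t : π i0 ≤ t
      frozen : ∀ k → 1 ≤ k → k ≤ c → k ≢ i0 → π k ≡ φ k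
      outside : ∀ k → 1 ≤ k → k ≤ c → k ≢ i0 → ¬ InWindow (π i0) t (π k)
      increasing : ∀ p q → c < p → p < q → q ≤ n → Block p q → π p < π q

  open Good

  i0≤n : i0 ≤ n
  i0≤n = ≤-trans i0≤c c≤n

  below-c⇒≢i0 : ∀ {p} → c < p → p ≢ i0
  below-c⇒≢i0 c<p refl = <-irrefl refl (≤-<-trans i0≤c c<p)

  good-ext : ∀ {π σ} → (∀ k → σ k ≡ π k) → Good π → Good σ
  good-ext {π} σ≗π G = record
    { bijection = bijection-ext σ≗π (bijection G)
    ; at-most-t = subst (_≤ t) (sym (σ≗π i0)) (at-most-t G)
    ; frozen = λ k a b d → trans (σ≗π k) (frozen G k a b d)
    ; outside = λ k a b d → subst₂ (λ x y → ¬ InWindow x t y) (sym (σ≗π i0)) (sym (σ≗π k)) (outside G k a b d)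
    ; increasing = λ p q a b d s → subst₂ _<_ (sym (σ≗π p)) (sym (σ≗π q)) (increasing G p q a b d s) }

  in-window⇒below-c : ∀ {π k} → Good π → 1 ≤ k → InWindow (π i0) t (π k) → c < k
  in-window⇒below-c {π} {k} G 1≤k inW with k ≤? c
  ... | no k≰c = ≰⇒> k≰c
  ... | yes k≤c with k ≟ i0
  ...   | yes refl = ⊥-elim (<-irrefl refl (proj₁ inW))
  ...   | no k≢i0 = ⊥-elim (outside G k 1≤k k≤c k≢i0 inW)

  target-below-c : ∀ {π} → Good π → π i0 < t → Σ ℕ λ p → c < p × p ≤ n × π p ≡ t
  target-below-c {π} G πi0<t with IsBijection.surjective (bijection G) t (≤-trans (s≤s z≤n) πi0<t) t≤n
  ... | p , 1≤p , p≤n , πp≡t =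
    p , in-window⇒below-c G 1≤p (subst (λ v → InWindow (π i0) t v) (sym πp≡t) (πi0<t , ≤-refl)) , p≤n , πp≡t

  FirstBelow : (ℕ → ℕ) → ℕ → Set
  FirstBelow π k = 1 ≤ k × k ≤ n × InWindow (π i0) t (π k)
                 × (∀ z → c < z → z < k → ¬ InWindow (π i0) t (π z))

  -- a block predecessor of that row has a value below π i0: it lies below
  -- the value at k ≤ t, so by minimality it is not above π i0
  predecessor-below : ∀ {π k} → Good π → FirstBelow π k →
    ∀ p → c < p → p < k → Block p k → π p < π i0
  predecessor-below {π} {k} G (1≤k , k≤n , (_ , πk≤t) , first) p c<p p<k blk = ≤∧≢⇒< πp≤πi0 πp≢πi0
    where
    πp<πk : π p < π k
    πp<πk = increasing G p k c<p p<k k≤n blk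
    πp≤πi0 : π p ≤ π i0
    πp≤πi0 with π i0 <? π p
    ... | no πi0≮πp = ≮⇒≥ πi0≮πp
    ... | yes πi0<πp = ⊥-elim (first p c<p p<k (πi0<πp , ≤-trans (<⇒≤ πp<πk) πk≤t))
    πp≢πi0 : π p ≢ π i0
    πp≢πi0 e = below-c⇒≢i0 c<p (IsBijection.injective (bijection G) p i0
                 (≤-trans (s≤s z≤n) c<p) (≤-trans (<⇒≤ p<k) k≤n) 1≤i0 i0≤n e)

  -- Swapping i0 with that row keeps each block increasing: the value π i0
  -- moved to row k is below the old value there, and above the values of
  -- the block predecessors of k.
  swap-increasing : ∀ {π k} → Good π → FirstBelow π k →
    ∀ p q → c < p → p < q → q ≤ n → Block p q → swap π i0 k p < swap π i0 k q
  swap-increasing {π} {k} G fb@(_ , _ , (πi0<πk , _) , _) p q c<p p<q q≤n blk with p ≟ k | q ≟ k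
  ... | yes refl | yes refl = ⊥-elim (<-irrefl refl p<q)
  ... | yes refl | no q≢k =
    subst₂ _<_ (sym (cong π (transpose-b i0 p))) (sym (swap-other π i0 p q (below-c⇒≢i0 (<-trans c<p p<q)) q≢k))
      (<-trans πi0<πk (increasing G p q c<p p<q q≤n blk))
  ... | no p≢k | yes refl =
    subst₂ _<_ (sym (swap-other π i0 q p (below-c⇒≢i0 c<p) p≢k)) (sym (cong π (transpose-b i0 q)))
      (predecessor-below G fb p c<p p<q blk)
  ... | no p≢k | no q≢k =
    subst₂ _<_ (sym (swap-other π i0 k p (below-c⇒≢i0 c<p) p≢k))
               (sym (swap-other π i0 k q (below-c⇒≢i0 (<-trans c<p p<q)) q≢k))
      (increasing G p q c<p p<q q≤n blk)

  good-swap : ∀ {π k} → Good π → FirstBelow π k → Good (swap π i0 k)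
  good-swap {π} {k} G fb@(1≤k , k≤n , inW@(πi0<πk , πk≤t) , _) = record
    { bijection = bijection-∘ (bijection G) (transpose-bijection n i0 k 1≤i0 i0≤n 1≤k k≤n)
    ; at-most-t = subst (_≤ t) (sym new-i0) πk≤t
    ; frozen = λ k′ a b d → trans (swap-other π i0 k k′ d (k′≢k b)) (frozen G k′ a b d)
    ; outside = λ k′ a b d → subst₂ (λ x y → ¬ InWindow x t y) (sym new-i0) (sym (swap-other π i0 k k′ d (k′≢k b)))
        (λ (πk<πk′ , πk′≤t) → outside G k′ a b d (<-trans πi0<πk πk<πk′ , πk′≤t))
    ; increasing = swap-increasing G fb }
    where
    new-i0 : swap π i0 k i0 ≡ π k
    new-i0 = cong π (transpose-a i0 k)
    k′≢k : ∀ {k′} → k′ ≤ c → k′ ≢ k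
    k′≢k k′≤c refl = <-irrefl refl (≤-<-trans k′≤c (in-window⇒below-c G 1≤k inW))

  -- Searching the window from a row a ≤ c + 1 to row n succeeds while
  -- π i0 < t (the row holding t qualifies), and finds the first row below
  -- c in the window (the rows ≤ c do not qualify).
  search-window : ∀ {π} a m → Good π → π i0 < t → 1 ≤ a → a ≤ suc c → a + m ≡ suc n →
    Σ ℕ λ k → findFirst (λ j → inWindow (π i0) t (π j)) (interval a m) ≡ just k × FirstBelow π k
  search-window {π} a m G πi0<t 1≤a a≤c+1 a+m≡n+1 =
    let (p , c<p , p≤n , πp≡t) = target-below-c G πi0<t
        (k , found , F) = findFirst-found (λ j → inWindow (π i0) t (π j)) a m p (≤-trans a≤c+1 c<p)
                            (subst (p <_) (sym a+m≡n+1) (s≤s p≤n))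
                            (inWindow-complete (π i0) t (π p) (subst (π i0 <_) (sym πp≡t) πi0<t , ≤-reflexive πp≡t))
    in k , found , ≤-trans 1≤a (IsFirst.lower F) , ≤-pred (subst (k <_) a+m≡n+1 (IsFirst.upper F))
     , inWindow-sound (π i0) t (π k) (IsFirst.holds F)
     , λ z c<z z<k → inWindow-false⁻ (π i0) t (π z) (IsFirst.minimal F z (≤-trans a≤c+1 c<z) z<k)

  Completes : (ℕ → ℕ) → List ℕ → Set
  Completes π r = Good (rotate π i0 r) × rotate π i0 r i0 ≡ t

  -- The chain from i0 exists and its rotation completes the step, by
  -- induction on the gap t - π i0: the rotation along i0, i_1, …, i_m is
  -- the transposition (i0 i_1) followed by the rotation along i0, i_2, …,
  -- i_m, which is the chain of the swapped permutation with a smaller gap.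
  chain-completes : ∀ f π → Good π → t ∸ π i0 ≤ f →
    Σ (List ℕ) λ r → chain n π t f i0 ≡ just r × Completes π r
  chain-completes-from : ∀ f π k → Good π → FirstBelow π k → t ∸ π k ≤ f →
    Σ (List ℕ) λ r → chain n π t f k ≡ just r × Completes π (k ∷ r)

  chain-completes-from f π k G fb@(_ , _ , (πi0<πk , _) , _) gap =
    let (r , ch , Gr , rotr) = chain-completes f σ (good-swap G fb) (subst (λ v → t ∸ v ≤ f) (sym σi0≡πk) gap)
        rest-above = chain-increasing n σ t f i0 ch
        rot≗ = rotate-∷ π i0 k r (All.map (λ { lt refl → <-irrefl refl lt }) rest-above)
                                 (All.map (λ { lt refl → <-asym πi0<πk (subst₂ _<_ σi0≡πk σk≡πi0 lt) }) rest-above)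
    in r , trans same-chain ch , good-ext rot≗ Gr , trans (rot≗ i0) rotr
    where
    σ = swap π i0 k
    σi0≡πk : σ i0 ≡ π k
    σi0≡πk = cong π (transpose-a i0 k)
    σk≡πi0 : σ k ≡ π i0
    σk≡πi0 = cong π (transpose-b i0 k)
    above : ∀ j → π k < π j → σ j ≡ π j
    above j πk<πj = swap-other π i0 k j (λ { refl → <-asym πi0<πk πk<πj }) (λ { refl → <-irrefl refl πk<πj })
    above′ : ∀ j → σ i0 < σ j → π j ≡ σ j
    above′ j σi0<σj = sym (swap-other π i0 k j (λ { refl → <-irrefl refl σi0<σj })
                        (λ { refl → <-asym πi0<πk (subst₂ _<_ σi0≡πk σk≡πi0 σi0<σj) }))
    same-chain : chain n π t f k ≡ chain n σ t f i0
    same-chain = chain-cong n π σ t f k i0 (sym σi0≡πk) above above′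

  chain-completes f π G gap with π i0 ≟ t
  ... | yes πi0≡t = [] , chain-done n π t f i0 πi0≡t , good-ext (rotate-[] π i0) G , trans (rotate-[] π i0 i0) πi0≡t
  ... | no πi0≢t with f | ≤∧≢⇒< (at-most-t G) πi0≢t
  ...   | zero | _ = ⊥-elim (πi0≢t (≤-antisym (at-most-t G) (m∸n≡0⇒m≤n (n≤0⇒n≡0 gap))))
  ...   | suc f | πi0<t =
    let (nx , found , fb@(_ , _ , (πi0<πnx , πnx≤t) , _)) = search-window 1 n G πi0<t ≤-refl (s≤s z≤n) refl
        (r , ch , completes) = chain-completes-from f π nx G fb (≤-pred (≤-trans (∸-monoʳ-< πi0<πnx πnx≤t) gap))
    in nx ∷ r , chain-next n π t f i0 πi0≢t (subst (λ l → findFirst _ l ≡ just nx) (sym (range≡interval 1 n)) found) ch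
     , completes

  greedy-step : ∀ π → Good π → π i0 < t →
    Σ (ℕ → ℕ) λ σ → (findFirst (λ k → inWindow (π i0) t (π k)) (range (suc c) n) >>= λ i1 →
                       chain n π t n i1 >>= λ r → just (rotate π i0 (i1 ∷ r))) ≡ just σ
                    × Good σ × σ i0 ≡ t
  greedy-step π G πi0<t =
    let (i1 , found , fb) = search-window (suc c) (n ∸ c) G πi0<t (s≤s z≤n) ≤-refl (cong suc (m+[n∸m]≡n c≤n))
        (r , ch , Gr , rotr) = chain-completes-from n π i1 G fb (≤-trans (m∸n≤m t (π i1)) t≤n)
    in rotate π i0 (i1 ∷ r)
     , trans (>>=-just _ (subst (λ l → findFirst _ l ≡ just i1) (sym (range≡interval (suc c) n)) found)) (>>=-just _ ch)
     , Gr , rotr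

module Procedure {n lam T} (P : IsPartition n lam) (S : IsSemistandard n lam T) where

  cl : ℕ → ℕ
  cl = colLen n lam

  -- rows p < q are not separated by the length of any of the columns 1, …, J
  -- (for J = λ₁ this is SameBlock)
  BlockUpTo : ℕ → ℕ → ℕ → Set
  BlockUpTo J p q = ∀ j → 1 ≤ j → j ≤ J → ¬ (p ≤ cl j × cl j < q)

  record AfterColumn (j : ℕ) (π : ℕ → ℕ) : Set where
    field
      bijection : IsBijection n π
      holds-column : ∀ k → 1 ≤ k → k ≤ cl j → π k ≡ T j k
      increasing : ∀ p q → cl j < p → p < q → q ≤ n → BlockUpTo j p q → π p < π q

  record InColumn (j i : ℕ) (π : ℕ → ℕ) : Set where
    field
      bijection : IsBijection n π
      pending : ∀ k → 1 ≤ k → k ≤ i → π k ≡ T j k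
      done : ∀ k → i < k → k ≤ cl (suc j) → π k ≡ T (suc j) k
      increasing : ∀ p q → cl (suc j) < p → p < q → q ≤ n → BlockUpTo (suc j) p q → π p < π q

  -- The box (j + 1, i + 1) as an instance of a single greedy step.
  module Box (j i : ℕ) (1≤j : 1 ≤ j) (i<c : suc i ≤ cl (suc j)) (π : ℕ → ℕ) where

    t≤n : T (suc j) (suc i) ≤ n
    t≤n = proj₂ (entry-≤ P S (suc j) (suc i) (s≤s z≤n) (s≤s z≤n) i<c)

    open GreedyStep n (cl (suc j)) (suc i) (T (suc j) (suc i)) (BlockUpTo (suc j)) π
                    (s≤s z≤n) i<c (colLen-≤ n lam (suc j)) t≤n public

    -- Before the step the invariant holds: rows above i + 1 carry smaller
    -- entries of column j, rows below it larger entries of column j + 1.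
    start : InColumn j (suc i) π → Good π
    start I = record
      { bijection = InColumn.bijection I
      ; at-most-t = subst (_≤ T (suc j) (suc i)) (sym πi0)
                      (row-weakly-increasing P S j (suc i) 1≤j (s≤s z≤n) i<c)
      ; frozen = λ _ _ _ _ → refl
      ; outside = outside
      ; increasing = InColumn.increasing I }
      where
      πi0 : π (suc i) ≡ T j (suc i)
      πi0 = InColumn.pending I (suc i) (s≤s z≤n) ≤-refl
      outside : ∀ k → 1 ≤ k → k ≤ cl (suc j) → k ≢ suc i → ¬ InWindow (π (suc i)) (T (suc j) (suc i)) (π k)
      outside k 1≤k k≤c k≢i0 (πi0<πk , πk≤t) with <-cmp k (suc i)
      ... | tri≈ _ k≡i0 _ = k≢i0 k≡i0
      ... | tri< k<i0 _ _ = <-asym πi0<πk (subst₂ _<_ (sym (InColumn.pending I k 1≤k (<⇒≤ k<i0))) (sym πi0)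
              (column-increasing P S j k (suc i) 1≤j 1≤k k<i0 (≤-trans i<c (colLen-antitone P j))))
      ... | tri> _ _ i0<k = <⇒≱ (subst (T (suc j) (suc i) <_) (sym (InColumn.done I k i0<k k≤c))
              (column-increasing P S (suc j) (suc i) k (s≤s z≤n) (s≤s z≤n) i0<k k≤c)) πk≤t

    finish : InColumn j (suc i) π → ∀ {σ} → Good σ → σ (suc i) ≡ T (suc j) (suc i) → InColumn j i σ
    finish I {σ} G σi0 = record
      { bijection = Good.bijection G
      ; pending = λ k 1≤k k≤i → trans (Good.frozen G k 1≤k (≤-trans (m≤n⇒m≤1+n k≤i) i<c) (λ { refl → <-irrefl refl k≤i }))
                                       (InColumn.pending I k 1≤k (m≤n⇒m≤1+n k≤i))
      ; done = done
      ; increasing = Good.increasing G }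
      where
      done : ∀ k → i < k → k ≤ cl (suc j) → σ k ≡ T (suc j) k
      done k i<k k≤c with m≤n⇒m<n∨m≡n i<k
      ... | inj₂ refl = σi0
      ... | inj₁ i0<k = trans (Good.frozen G k (≤-trans (s≤s z≤n) i0<k) k≤c (λ { refl → <-irrefl refl i0<k }))
                              (InColumn.done I k i0<k k≤c)

  box-step : ∀ j i π → 1 ≤ j → suc i ≤ cl (suc j) → InColumn j (suc i) π →
    Σ (ℕ → ℕ) λ π′ → step n lam T (suc j) (suc i) π ≡ just π′ × InColumn j i π′
  box-step j i π 1≤j i<c I with T j (suc i) ≟ T (suc j) (suc i)
  ... | yes same = π , refl , record
    { bijection = InColumn.bijection I
    ; pending = λ k 1≤k k≤i → InColumn.pending I k 1≤k (m≤n⇒m≤1+n k≤i)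
    ; done = done
    ; increasing = InColumn.increasing I }
    where
    done : ∀ k → i < k → k ≤ cl (suc j) → π k ≡ T (suc j) k
    done k i<k k≤c with m≤n⇒m<n∨m≡n i<k
    ... | inj₁ i0<k = InColumn.done I k i0<k k≤c
    ... | inj₂ refl = trans (InColumn.pending I (suc i) (s≤s z≤n) ≤-refl) same
  ... | no differ =
    let G = start I
        (σ , ran , Gσ , σi0) = greedy-step π G (≤∧≢⇒< (Good.at-most-t G) (λ e → differ (trans (sym πi0) e)))
    in σ , ran , finish I Gσ σi0
    where
    open Box j i 1≤j i<c π
    πi0 : π (suc i) ≡ T j (suc i)
    πi0 = InColumn.pending I (suc i) (s≤s z≤n) ≤-refl

  column-run : ∀ j i π → 1 ≤ j → i ≤ cl (suc j) → InColumn j i π →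
    Σ (ℕ → ℕ) λ π′ → column n lam T (suc j) i π ≡ just π′ × InColumn j 0 π′
  column-run j zero π _ _ I = π , refl , I
  column-run j (suc i) π 1≤j i<c I =
    let (π₁ , ran₁ , I₁) = box-step j i π 1≤j i<c I
        (π₂ , ran₂ , I₂) = column-run j i π₁ 1≤j (<⇒≤ i<c) I₁
    in π₂ , trans (>>=-just _ ran₁) ran₂ , I₂

  -- Once column j is in place, the values increase within every block cut
  -- out by the columns 1, …, j: below row c_j by the invariant, in the
  -- first c_j rows because column j of T is strictly increasing.
  after-column-increasing : ∀ j π → 1 ≤ j → AfterColumn j π →
    ∀ p q → 1 ≤ p → p < q → q ≤ n → BlockUpTo j p q → π p < π q
  after-column-increasing j π 1≤j A p q 1≤p p<q q≤n blk with cl j <? p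
  ... | yes c<p = AfterColumn.increasing A p q c<p p<q q≤n blk
  ... | no c≮p with cl j <? q
  ...   | yes c<q = ⊥-elim (blk j 1≤j ≤-refl (≮⇒≥ c≮p , c<q))
  ...   | no c≮q = subst₂ _<_ (sym (AfterColumn.holds-column A p 1≤p (≮⇒≥ c≮p)))
                              (sym (AfterColumn.holds-column A q (≤-trans 1≤p (<⇒≤ p<q)) (≮⇒≥ c≮q)))
                     (column-increasing P S j p q 1≤j 1≤p p<q (≮⇒≥ c≮q))

  enter-column : ∀ j π → 1 ≤ j → AfterColumn j π → InColumn j (cl (suc j)) π
  enter-column j π 1≤j A = record
    { bijection = AfterColumn.bijection A
    ; pending = λ k 1≤k k≤c → AfterColumn.holds-column A k 1≤k (≤-trans k≤c (colLen-antitone P j))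
    ; done = λ k c<k k≤c → ⊥-elim (<-irrefl refl (<-≤-trans c<k k≤c))
    ; increasing = λ p q c<p p<q q≤n blk → after-column-increasing j π 1≤j A p q (≤-trans (s≤s z≤n) c<p) p<q q≤n
                                             (λ j′ 1≤j′ j′≤j → blk j′ 1≤j′ (m≤n⇒m≤1+n j′≤j)) }

  leave-column : ∀ j π → InColumn j 0 π → AfterColumn (suc j) π
  leave-column j π I = record
    { bijection = InColumn.bijection I
    ; holds-column = InColumn.done I
    ; increasing = InColumn.increasing I }

  columns-run : ∀ m j π → 1 ≤ j → AfterColumn j π →
    Σ (ℕ → ℕ) λ π′ → columns n lam T (interval (suc j) m) π ≡ just π′ × AfterColumn (j + m) π′
  columns-run zero j π _ A = π , refl , subst (λ j′ → AfterColumn j′ π) (sym (+-identityʳ j)) A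
  columns-run (suc m) j π 1≤j A =
    let (π₁ , ran₁ , I₁) = column-run j (cl (suc j)) π 1≤j ≤-refl (enter-column j π 1≤j A)
        (π₂ , ran₂ , A₂) = columns-run m (suc j) π₁ (s≤s z≤n) (leave-column j π₁ I₁)
    in π₂ , trans (>>=-just _ ran₁) ran₂ , subst (λ j′ → AfterColumn j′ π₂) (sym (+-suc j m)) A₂

  after-last-column : ∀ π → 1 ≤ lam 1 → AfterColumn (lam 1) π → InS n lam π
  after-last-column π 1≤λ₁ A =
    bijection⇒IsPerm (AfterColumn.bijection A) , λ p q 1≤p p<q q≤n → after-column-increasing (lam 1) π 1≤λ₁ A p q 1≤p p<q q≤n

length-interval : ∀ a m → length (interval a m) ≡ m
length-interval a zero = refl
length-interval a (suc m) = cong suc (length-interval (suc a) m)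

∈-interval⁻ : ∀ {x} a m → x ∈ interval a m → a ≤ x × x < a + m
∈-interval⁻ a (suc m) (here refl) = ≤-refl , a<a+suc a m
∈-interval⁻ a (suc m) (there x∈) =
  let (a<x , x<) = ∈-interval⁻ (suc a) m x∈ in <⇒≤ a<x , <-+suc a m x<

∈-interval⁺ : ∀ {x} a m → a ≤ x → x < a + m → x ∈ interval a m
∈-interval⁺ {x} a zero a≤x x<a = ⊥-elim (<-irrefl refl (<-≤-trans (subst (x <_) (+-identityʳ a) x<a) a≤x))
∈-interval⁺ {x} a (suc m) a≤x x< with m≤n⇒m<n∨m≡n a≤x
... | inj₂ refl = here refl
... | inj₁ a<x = there (∈-interval⁺ (suc a) m a<x (subst (x <_) (+-suc a m) x<))

nth-∈ : ∀ l k → k < length l → nth l k ∈ l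
nth-∈ (x ∷ xs) zero _ = here refl
nth-∈ (x ∷ xs) (suc k) (s≤s k<) = there (nth-∈ xs k k<)

∈⇒nth : ∀ {x} l → x ∈ l → Σ ℕ λ k → k < length l × nth l k ≡ x
∈⇒nth (y ∷ ys) (here refl) = 0 , s≤s z≤n , refl
∈⇒nth (y ∷ ys) (there x∈) = let (k , k< , e) = ∈⇒nth ys x∈ in suc k , s≤s k< , e

nth-++ˡ : ∀ xs ys k → k < length xs → nth (xs ++ ys) k ≡ nth xs k
nth-++ˡ (x ∷ xs) ys zero _ = refl
nth-++ˡ (x ∷ xs) ys (suc k) (s≤s k<) = nth-++ˡ xs ys k k<

nth-++ʳ : ∀ xs ys k → nth (xs ++ ys) (length xs + k) ≡ nth ys k
nth-++ʳ [] ys k = refl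
nth-++ʳ (x ∷ xs) ys k = nth-++ʳ xs ys k

nth-map-interval : ∀ (f : ℕ → ℕ) a m k → k < m → nth (map f (interval a m)) k ≡ f (a + k)
nth-map-interval f a (suc m) zero _ = cong f (sym (+-identityʳ a))
nth-map-interval f a (suc m) (suc k) (s≤s k<) = trans (nth-map-interval f (suc a) m k k<) (cong f (sym (+-suc a k)))

nth-injective : ∀ {l} → Unique l → ∀ a b → a < length l → b < length l → nth l a ≡ nth l b → a ≡ b
nth-injective (_ ∷ _) zero zero _ _ _ = refl
nth-injective {x ∷ xs} (x∉ ∷ _) zero (suc b) _ (s≤s b<) e = ⊥-elim (All.lookup x∉ (nth-∈ xs b b<) e)
nth-injective {x ∷ xs} (x∉ ∷ _) (suc a) zero (s≤s a<) _ e = ⊥-elim (All.lookup x∉ (nth-∈ xs a a<) (sym e))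
nth-injective (_ ∷ u) (suc a) (suc b) (s≤s a<) (s≤s b<) e = cong suc (nth-injective u a b a< b< e)

nth-bijection : ∀ n L → length L ≡ n → Unique L → All (λ v → 1 ≤ v × v ≤ n) L →
  (∀ v → 1 ≤ v → v ≤ n → v ∈ L) → IsBijection n (λ p → nth L (p ∸ 1))
nth-bijection n L len unique bounded covers = record
  { bounded = λ { (suc p) _ p<n → All.lookup bounded (nth-∈ L p (subst (p <_) (sym len) p<n)) }
  ; injective = λ { (suc p) (suc q) _ p<n _ q<n e →
      cong suc (nth-injective unique p q (subst (p <_) (sym len) p<n) (subst (q <_) (sym len) q<n) e) }
  ; surjective = λ v 1≤v v≤n → let (k , k< , e) = ∈⇒nth L (covers v 1≤v v≤n)
                               in suc k , s≤s z≤n , subst (k <_) len k< , e }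

elemB-complete : ∀ {x} l → x ∈ l → elemB x l ≡ true
elemB-complete {x} (y ∷ ys) (here refl) rewrite ≡ᵇ-refl x = refl
elemB-complete {x} (y ∷ ys) (there x∈) rewrite elemB-complete ys x∈ = ∨-zeroʳ (x ≡ᵇ y)

elemB-sound : ∀ {x} l → elemB x l ≡ true → x ∈ l
elemB-sound {x} (y ∷ ys) e with x ≡ᵇ y in e₁
... | true = here (≡ᵇ-sound e₁)
... | false = there (elemB-sound ys e)

∈-filterB⁻ : ∀ (P : ℕ → Bool) {x} l → x ∈ filterB P l → P x ≡ true × x ∈ l
∈-filterB⁻ P (y ∷ ys) x∈ with P y in e
∈-filterB⁻ P (y ∷ ys) (here refl) | true = e , here refl
∈-filterB⁻ P (y ∷ ys) (there x∈) | true = let (px , x∈ys) = ∈-filterB⁻ P ys x∈ in px , there x∈ys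
∈-filterB⁻ P (y ∷ ys) x∈ | false = let (px , x∈ys) = ∈-filterB⁻ P ys x∈ in px , there x∈ys

∈-filterB⁺ : ∀ (P : ℕ → Bool) {x} l → x ∈ l → P x ≡ true → x ∈ filterB P l
∈-filterB⁺ P (y ∷ ys) (here refl) px rewrite px = here refl
∈-filterB⁺ P (y ∷ ys) (there x∈) px with P y
... | true = there (∈-filterB⁺ P ys x∈ px)
... | false = ∈-filterB⁺ P ys x∈ px

filterB-length-split : ∀ (P : ℕ → Bool) l → length (filterB P l) + length (filterB (λ v → not (P v)) l) ≡ length l
filterB-length-split P [] = refl
filterB-length-split P (x ∷ xs) with P x
... | true = cong suc (filterB-length-split P xs)
... | false = trans (+-suc _ _) (cong suc (filterB-length-split P xs))

filterB-cong-interval : ∀ P Q a m → (∀ v → a ≤ v → P v ≡ Q v) → filterB P (interval a m) ≡ filterB Q (interval a m)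
filterB-cong-interval P Q a zero _ = refl
filterB-cong-interval P Q a (suc m) P≗Q rewrite P≗Q a ≤-refl with Q a
... | true = cong (a ∷_) (filterB-cong-interval P Q (suc a) m (λ v a<v → P≗Q v (<⇒≤ a<v)))
... | false = filterB-cong-interval P Q (suc a) m (λ v a<v → P≗Q v (<⇒≤ a<v))

data Ascending : ℕ → List ℕ → Set where
  [] : ∀ {lo} → Ascending lo []
  _∷_ : ∀ {lo x xs} → lo ≤ x → Ascending (suc x) xs → Ascending lo (x ∷ xs)

ascending-weaken : ∀ {lo′ lo l} → lo′ ≤ lo → Ascending lo l → Ascending lo′ l
ascending-weaken _ [] = []
ascending-weaken lo′≤lo (lo≤x ∷ xs) = ≤-trans lo′≤lo lo≤x ∷ xs

ascending-interval : ∀ a m → Ascending a (interval a m)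
ascending-interval a zero = []
ascending-interval a (suc m) = ≤-refl ∷ ascending-interval (suc a) m

ascending-filterB : ∀ {lo} (P : ℕ → Bool) l → Ascending lo l → Ascending lo (filterB P l)
ascending-filterB P [] [] = []
ascending-filterB P (x ∷ xs) (lo≤x ∷ asc) with P x
... | true = lo≤x ∷ ascending-filterB P xs asc
... | false = ascending-weaken (≤-trans lo≤x (n≤1+n x)) (ascending-filterB P xs asc)

ascending-map-interval : ∀ lo (f : ℕ → ℕ) a m → (∀ x → a ≤ x → suc x < a + m → f x < f (suc x)) →
  (0 < m → lo ≤ f a) → Ascending lo (map f (interval a m))
ascending-map-interval lo f a zero _ _ = []
ascending-map-interval lo f a (suc zero) _ first = first (s≤s z≤n) ∷ []
ascending-map-interval lo f a (suc (suc m)) step first = first (s≤s z≤n) ∷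
  ascending-map-interval (suc (f a)) f (suc a) (suc m)
    (λ x a<x x+1< → step x (<⇒≤ a<x) (<-+suc a (suc m) x+1<))
    (λ _ → step a ≤-refl (<-+suc a (suc m) (a<a+suc (suc a) m)))

ascending-lower : ∀ {lo l} → Ascending lo l → All (lo ≤_) l
ascending-lower [] = []
ascending-lower (lo≤x ∷ asc) = lo≤x ∷ All.map (λ x<y → ≤-trans lo≤x (<⇒≤ x<y)) (ascending-lower asc)

ascending-unique : ∀ {lo l} → Ascending lo l → Unique l
ascending-unique [] = []
ascending-unique (_ ∷ asc) = All.map (λ x<y x≡y → <-irrefl x≡y x<y) (ascending-lower asc) ∷ ascending-unique asc

ascending-nth : ∀ {lo} l a b → Ascending lo l → a < b → b < length l → nth l a < nth l b
ascending-nth (x ∷ xs) zero (suc b) (_ ∷ asc) _ (s≤s b<) = All.lookup (ascending-lower asc) (nth-∈ xs b b<)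
ascending-nth (x ∷ xs) (suc a) (suc b) (_ ∷ asc) (s≤s a<b) (s≤s b<) = ascending-nth xs a b asc a<b b<

elemB-below : ∀ {lo} v l → Ascending lo l → v < lo → elemB v l ≡ false
elemB-below v [] [] _ = refl
elemB-below v (x ∷ xs) (lo≤x ∷ asc) v<lo rewrite ≡ᵇ-false {v} {x} (λ { refl → <-irrefl refl (<-≤-trans v<lo lo≤x) }) =
  elemB-below v xs asc (<-trans v<lo (s≤s lo≤x))

filterB-elemB : ∀ s a m → Ascending a s → All (_< a + m) s → filterB (λ v → elemB v s) (interval a m) ≡ s
filterB-elemB [] a zero _ _ = refl
filterB-elemB (x ∷ xs) a zero (a≤x ∷ _) (x< ∷ _) =
  ⊥-elim (<-irrefl refl (<-≤-trans (subst (x <_) (+-identityʳ a) x<) a≤x))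
filterB-elemB [] a (suc m) _ _ = filterB-elemB [] (suc a) m [] []
filterB-elemB (x ∷ xs) a (suc m) (a≤x ∷ asc) bound with m≤n⇒m<n∨m≡n a≤x
... | inj₂ refl rewrite ≡ᵇ-refl a =
  cong (a ∷_) (trans (filterB-cong-interval _ (λ v → elemB v xs) (suc a) m
                        (λ v a<v → cong (_∨ elemB v xs) (≡ᵇ-false {v} {a} (λ { refl → <-irrefl refl a<v }))))
                     (filterB-elemB xs (suc a) m asc (All.tail shifted)))
  where
  shifted : All (_< suc a + m) (a ∷ xs)
  shifted = All.map (λ {v} v< → subst (v <_) (+-suc a m) v<) bound
... | inj₁ a<x rewrite elemB-below a (x ∷ xs) (a<x ∷ asc) ≤-refl =
  filterB-elemB (x ∷ xs) (suc a) m (a<x ∷ asc) (All.map (λ {v} v< → subst (v <_) (+-suc a m) v<) bound)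

module Initial {n lam T} (P : IsPartition n lam) (S : IsSemistandard n lam T) where

  open Procedure P S

  c₁ : ℕ
  c₁ = colLen n lam 1

  col₁ : List ℕ
  col₁ = map (T 1) (range 1 c₁)

  rest : List ℕ
  rest = filterB (λ v → not (elemB v col₁)) (range 1 n)

  listing : List ℕ
  listing = col₁ ++ rest

  col₁≡ : col₁ ≡ map (T 1) (interval 1 c₁)
  col₁≡ = cong (map (T 1)) (range≡interval 1 c₁)

  col₁-length : length col₁ ≡ c₁
  col₁-length = trans (cong length col₁≡) (trans (length-map (T 1) (interval 1 c₁)) (length-interval 1 c₁))

  col₁-nth : ∀ k → k < c₁ → nth col₁ k ≡ T 1 (suc k)
  col₁-nth k k<c₁ = trans (cong (λ l → nth l k) col₁≡) (nth-map-interval (T 1) 1 c₁ k k<c₁)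

  col₁-ascending : Ascending 1 col₁
  col₁-ascending = subst (Ascending 1) (sym col₁≡) (ascending-map-interval 1 (T 1) 1 c₁
    (λ x 1≤x x+1≤c₁ → column-increasing P S 1 x (suc x) ≤-refl 1≤x ≤-refl (≤-pred x+1≤c₁))
    (λ 0<c₁ → proj₁ (entry-≤ P S 1 1 ≤-refl ≤-refl 0<c₁)))

  col₁-bounded : All (λ v → 1 ≤ v × v ≤ n) col₁
  col₁-bounded = All.tabulate λ {v} v∈ →
    let (k , k< , e) = ∈⇒nth col₁ v∈ ; k<c₁ = subst (k <_) col₁-length k<
    in subst (λ v → 1 ≤ v × v ≤ n) (trans (sym (col₁-nth k k<c₁)) e) (entry-≤ P S 1 (suc k) ≤-refl (s≤s z≤n) k<c₁)

  rest-ascending : Ascending 1 rest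
  rest-ascending = ascending-filterB _ (range 1 n) (subst (Ascending 1) (sym (range≡interval 1 n)) (ascending-interval 1 n))

  ∈-rest⁻ : ∀ {v} → v ∈ rest → (1 ≤ v × v ≤ n) × elemB v col₁ ≡ false
  ∈-rest⁻ {v} v∈ with ∈-filterB⁻ (λ v → not (elemB v col₁)) (range 1 n) v∈
  ... | not-in , v∈range = (let (1≤v , v<) = ∈-interval⁻ 1 n (subst (v ∈_) (range≡interval 1 n) v∈range) in 1≤v , ≤-pred v<)
                         , not-true not-in
    where not-true : ∀ {b} → not b ≡ true → b ≡ false
          not-true {false} _ = refl

  col₁+rest : c₁ + length rest ≡ n
  col₁+rest = begin
    c₁ + length rest
      ≡⟨ cong (_+ length rest) (sym (trans (cong length col₁-filtered) col₁-length)) ⟩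
    length (filterB (λ v → elemB v col₁) (range 1 n)) + length rest
      ≡⟨ filterB-length-split (λ v → elemB v col₁) (range 1 n) ⟩
    length (range 1 n)
      ≡⟨ cong length (range≡interval 1 n) ⟩
    length (interval 1 n)
      ≡⟨ length-interval 1 n ⟩
    n ∎
    where
    open ≡-Reasoning
    col₁-filtered : filterB (λ v → elemB v col₁) (range 1 n) ≡ col₁
    col₁-filtered = trans (cong (filterB (λ v → elemB v col₁)) (range≡interval 1 n))
      (filterB-elemB col₁ 1 n col₁-ascending (All.map (λ b → s≤s (proj₂ b)) col₁-bounded))

  listing-length : length listing ≡ n
  listing-length = trans (length-++ col₁) (trans (cong (_+ length rest) col₁-length) col₁+rest)

  listing-unique : Unique listing
  listing-unique = Unique.++⁺ (ascending-unique col₁-ascending) (ascending-unique rest-ascending)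
    λ (v∈col₁ , v∈rest) → case trans (sym (elemB-complete col₁ v∈col₁)) (proj₂ (∈-rest⁻ v∈rest)) of λ ()

  listing-covers : ∀ v → 1 ≤ v → v ≤ n → v ∈ listing
  listing-covers v 1≤v v≤n with elemB v col₁ in e
  ... | true = ∈-++⁺ˡ (elemB-sound col₁ e)
  ... | false = ∈-++⁺ʳ col₁ (∈-filterB⁺ (λ v → not (elemB v col₁)) (range 1 n)
                  (subst (v ∈_) (sym (range≡interval 1 n)) (∈-interval⁺ 1 n 1≤v (s≤s v≤n))) (cong not e))

  listing-bounded : All (λ v → 1 ≤ v × v ≤ n) listing
  listing-bounded = All.tabulate λ v∈ →
    either (All.lookup col₁-bounded) (λ v∈rest → proj₁ (∈-rest⁻ v∈rest)) (∈-++⁻ col₁ v∈)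

  listing-beyond : ∀ p → c₁ ≤ p → nth listing p ≡ nth rest (p ∸ c₁)
  listing-beyond p c₁≤p = begin
    nth listing p                          ≡⟨ cong (nth listing) (sym (m+[n∸m]≡n c₁≤p)) ⟩
    nth listing (c₁ + (p ∸ c₁))            ≡⟨ cong (λ c → nth listing (c + (p ∸ c₁))) (sym col₁-length) ⟩
    nth listing (length col₁ + (p ∸ c₁))   ≡⟨ nth-++ʳ col₁ rest (p ∸ c₁) ⟩
    nth rest (p ∸ c₁)                      ∎
    where open ≡-Reasoning

  -- π^{(1,1)} satisfies the invariant after column 1: below row c₁ it
  -- runs through rest, which is increasing.
  initial-state : AfterColumn 1 (initPerm n lam T)
  initial-state = record
    { bijection = nth-bijection n listing listing-length listing-unique listing-bounded listing-covers
    ; holds-column = λ { (suc k) _ k<c₁ → trans (nth-++ˡ col₁ rest k (subst (k <_) (sym col₁-length) k<c₁)) (col₁-nth k k<c₁) }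
    ; increasing = increasing }
    where
    increasing : ∀ p q → c₁ < p → p < q → q ≤ n → BlockUpTo 1 p q → initPerm n lam T p < initPerm n lam T q
    increasing (suc p) (suc q) (s≤s c₁≤p) (s≤s p<q) q<n _ =
      subst₂ _<_ (sym (listing-beyond p c₁≤p)) (sym (listing-beyond q c₁≤q))
        (ascending-nth rest (p ∸ c₁) (q ∸ c₁) rest-ascending (∸-monoˡ-< p<q c₁≤p)
          (+-cancelˡ-< c₁ (q ∸ c₁) (length rest) (subst₂ _<_ (sym (m+[n∸m]≡n c₁≤q)) (sym col₁+rest) q<n)))
      where c₁≤q = ≤-trans c₁≤p (<⇒≤ p<q)

-- Start from π^{(1,1)}, run the columns 2, …, λ₁ (λ₁ ≥ 1 as λ ≠ 0), and
-- read off membership in S_n^λ from the invariant after column λ₁.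
mainTheorem8 : (n : ℕ) → 2 ≤ n → (lam : ℕ → ℕ) → IsPartition n lam → NonzeroPartition n lam
    → lam n ≡ 0 → (T : ℕ → ℕ → ℕ) → IsSemistandard n lam T
    → Σ (ℕ → ℕ) λ πT → (greedy n lam T ≡ just πT) × InS n lam πT
mainTheorem8 n _ lam P (i , 1≤i , i≤n , λi≢0) _ T S =
  let (πT , ran , after) = columns-run (lam 1 ∸ 1) 1 (initPerm n lam T) ≤-refl initial-state
  in πT , trans (cong (λ l → columns n lam T l (initPerm n lam T)) (range≡interval 2 (lam 1))) ran
     , after-last-column πT 1≤λ₁ (subst (λ j → AfterColumn j πT) (m+[n∸m]≡n 1≤λ₁) after)
  where
  open Procedure P S
  open Initial P S
  1≤λ₁ : 1 ≤ lam 1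
  1≤λ₁ = ≤-trans (n≢0⇒n>0 λi≢0) (partition-antitone P 1 i ≤-refl 1≤i i≤n)
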